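{- Let $s\in\{3,6,12,15,21,24,30,33,39\}$ (so that $\gcd(81,s)=3$). Then in each of the following triples, the three circulant graphs are (pairwise) Type-2 isomorphic with respect to $m=3$: (d) $C_{81}(1,s,26,28)$, $C_{81}(s,8,19,35)$, $C_{81}(s,10,17,37)$; (e) $C_{81}(2,s,25,29)$, $C_{81}(s,7,20,34)$, $C_{81}(s,11,16,38)$; (f) $C_{81}(s,4,23,31)$, $C_{81}(s,13,14,40)$, $C_{81}(s,5,22,32)$.
   Context: For an integer $n\ge 2$ and a set $R\subseteq\{1,\dots,\lfloor n/2\rfloor\}$, the circulant graph $C_n(R)$ has vertex set $\{v_0,\dots,v_{n-1}\}$ (indices modulo $n$), and $v_iv_j$ is an edge iff $i-j\equiv \pm r \pmod n$ for some $r\in R$; we write $C_n(a,b,c,d)$ for $C_n(\{a,b,c,d\})$, etc. The reflexive modular reduction of a collection of integers reduces each modulo $n$ to $r'\in\{0,\dots,n-1\}$ and then replaces $r'$ by $n-r'$ whenever $r'>n/2$. For $x$ with $\gcd(n,x)=1$, $xR$ denotes the reflexive modular reduction of $\{xr: r\in R\}$. Given $m>1$ and $0\le t\le n/m-1$, the map $\theta_{n,m,t}$ sends the vertex $v_x$ ($x\in\mathbb{Z}_n$, written $x=qm+j$ with $0\le j\le m-1$) to $u_{x+jtm}$ (subscripts modulo $n$, where $u_0,\dots,u_{n-1}$ are the vertices of $K_n$) and an edge $(v_x,v_{x+s})$ to $(\theta_{n,m,t}(v_x),\theta_{n,m,t}(v_{x+s}))$. Two circulant graphs $C_n(R)$ and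 $C_n(S)$ are called Type-2 isomorphic with respect to $m$ if: $R\neq S$ and $|R|=|S|\ge 3$; there is $r\in R\cap S$ with $m\mid\gcd(n,r)$ and $m^3\mid n$; there is $t$ with $1\le t\le n/m-1$ such that $\theta_{n,m,t}$ maps the edge set of $C_n(R)$ exactly onto the edge set of $C_n(S)$ (i.e. $\theta_{n,m,t}(C_n(R))=C_n(S)$); and $S\neq xR$ for every $x$ with $\gcd(x,n)=1$. -}

module Defs where

open import Data.Nat using (ℕ; zero; suc; _+_; _*_; _∸_; _^_; _≤_; _<_; NonZero)
open import Data.Nat.Divisibility using (_∣_)
open import Data.Nat.DivMod using (_/_; _%_)
open import Data.Nat.GCD using (gcd)
open import Data.Nat.Properties using (_≤?_)
open import Data.List using (List; []; _∷_; length; map)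
open import Data.List.Membership.Propositional using (_∈_)
open import Data.List.Relation.Unary.Unique.Propositional using (Unique)
open import Data.List.Relation.Unary.All using (All)
open import Data.Product using (Σ; ∃; ∃-syntax; _×_; _,_)
open import Data.Sum using (_⊎_)
open import Relation.Nullary using (¬_; yes; no)
open import Relation.Binary.PropositionalEquality using (_≡_)

-- Finite sets of natural numbers are represented by duplicate-free lists;
-- two lists denote the same set iff they have the same members.
SetEq : List ℕ → List ℕ → Set
SetEq A B = ∀ a → (a ∈ A → a ∈ B) × (a ∈ B → a ∈ A)

ValidConn : ℕ → List ℕ → Set
ValidConn n R = Unique R × All (λ r → 1 ≤ r × 2 * r ≤ n) R

-- Edge relation of C_n(R) on vertices v_0,…,v_{n-1} (identified with 0,…,n-1):
-- v_i v_j is an edge iff i - j ≡ ± r (mod n) for some r ∈ R.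
CircEdge : (n : ℕ) → .{{_ : NonZero n}} → List ℕ → ℕ → ℕ → Set
CircEdge n R i j = ∃[ r ] (r ∈ R × ((i % n ≡ (j + r) % n) ⊎ (j % n ≡ (i + r) % n)))

-- Reflexive modular reduction of a single integer (n/2 compared exactly:
-- r' > n/2  iff  2 r' > n).
refRed : (n : ℕ) → .{{_ : NonZero n}} → ℕ → ℕ
refRed n a with 2 * (a % n) ≤? n
... | yes _ = a % n
... | no  _ = n ∸ (a % n)

scaleSet : (n : ℕ) → .{{_ : NonZero n}} → ℕ → List ℕ → List ℕ
scaleSet n x R = map (λ r → refRed n (x * r)) R

theta : (n m t : ℕ) → .{{_ : NonZero n}} → .{{_ : NonZero m}} → ℕ → ℕ
theta n m t x = (x + (x % m) * t * m) % n

-- θ_{n,m,t}(C_n(R)) = C_n(S): the image of the edge set of C_n(R) equals the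
-- edge set of C_n(S) (as a set of vertex pairs of K_n).
ThetaMaps : (n m t : ℕ) → .{{_ : NonZero n}} → .{{_ : NonZero m}} →
            List ℕ → List ℕ → Set
ThetaMaps n m t R S =
  ∀ a b → a < n → b < n →
    (CircEdge n S a b →
       ∃[ x ] ∃[ y ] (x < n × y < n × CircEdge n R x y ×
                      theta n m t x ≡ a × theta n m t y ≡ b))
    × ((∃[ x ] ∃[ y ] (x < n × y < n × CircEdge n R x y ×
                      theta n m t x ≡ a × theta n m t y ≡ b)) →
       CircEdge n S a b)

Type2Iso : (n m : ℕ) → .{{_ : NonZero n}} → .{{_ : NonZero m}} →
           List ℕ → List ℕ → Set
Type2Iso n m R S =
  ValidConn n R × ValidConn n S ×
  ¬ SetEq R S × length R ≡ length S × 3 ≤ length R ×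
  (∃[ r ] (r ∈ R × r ∈ S × m ∣ gcd n r)) × (m ^ 3) ∣ n ×
  (∃[ t ] (1 ≤ t × t ≤ n / m ∸ 1 × ThetaMaps n m t R S)) ×
  (∀ x → gcd x n ≡ 1 → ¬ SetEq S (scaleSet n x R))

PairwiseType2 : (n m : ℕ) → .{{_ : NonZero n}} → .{{_ : NonZero m}} →
                List ℕ → List ℕ → List ℕ → Set
PairwiseType2 n m A B C =
  Type2Iso n m A B × Type2Iso n m B A ×
  Type2Iso n m A C × Type2Iso n m C A ×
  Type2Iso n m B C × Type2Iso n m C B

sValues : List ℕ
sValues = 3 ∷ 6 ∷ 12 ∷ 15 ∷ 21 ∷ 24 ∷ 30 ∷ 33 ∷ 39 ∷ []

-- θ_(n,m,t) shifts the residue class j mod m by j·t·m (mod n) and preserves residues mod m,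
-- so θ_(n,m,u) inverts it whenever (t + u)·m ≡ n. Hence θ_t maps C_n(R) onto C_n(S) as soon
-- as θ_t sends every edge of C_n(R) into C_n(S) and θ_(n/m ∸ t) sends every edge of C_n(S)
-- into C_n(R): finitely many decidable conditions. For n = 81, m = 3 each triple is permuted
-- cyclically by θ_3 and in the opposite direction by θ_6 = θ_3², and the remaining clauses of
-- the definition (including S ≠ xR over all residues x) are decided by evaluation.
module Submission where

open import Defs
open import Data.Nat using (ℕ; _+_; _*_; _∸_; _^_; _≤_; _<_; NonZero; _≟_)
open import Data.Nat.Properties using (_≤?_; +-comm; ≤-trans; m∸n≤m; m+[n∸m]≡n; allUpTo?)
open import Data.Nat.Divisibility using (_∣_; _∣?_; divides; ∣-trans; m∣m*n; n∣m*n)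
open import Data.Nat.DivMod
  using (_%_; _/_; m%n<n; m%n%n≡m%n; m<n⇒m%n≡m; [m+kn]%n≡m%n; %-distribˡ-+; %-distribˡ-*;
         %-remove-+ʳ; m∣n⇒o%n%m≡o%m; m/n*n≡m)
open import Data.Nat.GCD using (gcd)
open import Data.Nat.Solver using (module +-*-Solver)
open import Data.List using (List; []; _∷_; length)
open import Data.List.Properties using (map-cong)
open import Data.List.Membership.Propositional using (_∈_; find; lose)
open import Data.List.Membership.DecPropositional _≟_ using (_∈?_)
open import Data.List.Relation.Unary.All using (All; all?; lookup)
open import Data.List.Relation.Unary.Any using (any?)
open import Data.List.Relation.Unary.Unique.DecPropositional _≟_ using (unique?)
open import Data.List.Relation.Binary.Subset.Propositional using (_⊆_)
open import Data.List.Relation.Binary.Subset.DecPropositional _≟_ using (_⊆?_)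
open import Data.Product using (_×_; _,_; proj₁; proj₂; ∃-syntax)
open import Data.Sum using (inj₁; inj₂)
open import Relation.Nullary using (¬_; Dec; yes; no; ¬?; contradiction)
open import Relation.Nullary.Decidable using (map′; _×-dec_; _⊎-dec_; from-yes)
open import Relation.Binary.PropositionalEquality
  using (_≡_; refl; sym; trans; cong; subst; module ≡-Reasoning)

open ≡-Reasoning

[m%n+o]%n≡[m+o]%n : ∀ m o n .{{_ : NonZero n}} → (m % n + o) % n ≡ (m + o) % n
[m%n+o]%n≡[m+o]%n m o n = begin
  (m % n + o) % n           ≡⟨ %-distribˡ-+ (m % n) o n ⟩
  (m % n % n + o % n) % n   ≡⟨ cong (λ k → (k + o % n) % n) (m%n%n≡m%n m n) ⟩
  (m % n + o % n) % n       ≡⟨ %-distribˡ-+ m o n ⟨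
  (m + o) % n               ∎

[m%n*o]%n≡[m*o]%n : ∀ m o n .{{_ : NonZero n}} → (m % n * o) % n ≡ (m * o) % n
[m%n*o]%n≡[m*o]%n m o n = begin
  (m % n * o) % n           ≡⟨ %-distribˡ-* (m % n) o n ⟩
  (m % n % n * (o % n)) % n ≡⟨ cong (λ k → (k * (o % n)) % n) (m%n%n≡m%n m n) ⟩
  (m % n * (o % n)) % n     ≡⟨ %-distribˡ-* m o n ⟨
  (m * o) % n               ∎

module _ {n m : ℕ} .{{_ : NonZero n}} .{{_ : NonZero m}} where

  theta<n : ∀ t x → theta n m t x < n
  theta<n t x = m%n<n _ n

  theta-residue : m ∣ n → ∀ t x → theta n m t x % m ≡ x % m
  theta-residue m∣n t x = begin
    (x + x % m * t * m) % n % m ≡⟨ m∣n⇒o%n%m≡o%m m n _ m∣n ⟩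
    (x + x % m * t * m) % m     ≡⟨ %-remove-+ʳ x (n∣m*n (x % m * t)) ⟩
    x % m                       ∎

  theta-cancel : ∀ {t u x} → (t + u) * m ≡ n → x < n → theta n m u (theta n m t x) ≡ x
  theta-cancel {t} {u} {x} [t+u]*m≡n x<n = begin
    (y % n + y % n % m * u * m) % n ≡⟨ cong (λ k → (y % n + k * u * m) % n) (theta-residue m∣n t x) ⟩
    (y % n + j * u * m) % n         ≡⟨ [m%n+o]%n≡[m+o]%n y (j * u * m) n ⟩
    (y + j * u * m) % n             ≡⟨ cong (_% n) shift ⟩
    (x + j * n) % n                 ≡⟨ [m+kn]%n≡m%n x j n ⟩
    x % n                           ≡⟨ m<n⇒m%n≡m x<n ⟩
    x                               ∎
    where
    j = x % m
    y = x + j * t * m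

    m∣n : m ∣ n
    m∣n = divides (t + u) (sym [t+u]*m≡n)

    open +-*-Solver
    shift : y + j * u * m ≡ x + j * n
    shift = begin
      x + j * t * m + j * u * m ≡⟨ solve 5 (λ x j t u m → x :+ j :* t :* m :+ j :* u :* m
                                                        := x :+ j :* ((t :+ u) :* m)) refl x j t u m ⟩
      x + j * ((t + u) * m)     ≡⟨ cong (λ k → x + j * k) [t+u]*m≡n ⟩
      x + j * n                 ∎

-- Every edge of C_n(R) is {(y + r) % n, y} for some y < n and r ∈ R.
MapsEdges : (n : ℕ) .{{_ : NonZero n}} → (ℕ → ℕ) → List ℕ → List ℕ → Set
MapsEdges n f R S = ∀ {y} → y < n → All (λ r → CircEdge n S (f ((y + r) % n)) (f y)) R

module _ {n : ℕ} .{{_ : NonZero n}} where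

  circEdge-sym : ∀ {R i j} → CircEdge n R i j → CircEdge n R j i
  circEdge-sym (r , r∈R , inj₁ e) = r , r∈R , inj₂ e
  circEdge-sym (r , r∈R , inj₂ e) = r , r∈R , inj₁ e

  circEdge? : ∀ R i j → Dec (CircEdge n R i j)
  circEdge? R i j = map′ find (λ (r , r∈R , e) → lose r∈R e)
    (any? (λ r → (i % n ≟ (j + r) % n) ⊎-dec (j % n ≟ (i + r) % n)) R)

  mapsEdges? : ∀ f R S → Dec (MapsEdges n f R S)
  mapsEdges? f R S = allUpTo? (λ y → all? (λ r → circEdge? S (f ((y + r) % n)) (f y)) R) n

  mapEdge : ∀ {f R S i j} → MapsEdges n f R S → i < n → j < n →
            CircEdge n R i j → CircEdge n S (f i) (f j)
  mapEdge {f} {S = S} {i} {j} maps i<n j<n (r , r∈R , inj₁ i≡j+r) =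
    subst (λ k → CircEdge n S (f k) (f j)) (canonical i<n i≡j+r) (lookup (maps j<n) r∈R)
    where
    canonical : ∀ {k l} → k < n → k % n ≡ l → l ≡ k
    canonical k<n e = trans (sym e) (m<n⇒m%n≡m k<n)
  mapEdge {f} {S = S} {i} {j} maps i<n j<n (r , r∈R , inj₂ j≡i+r) =
    circEdge-sym (mapEdge maps j<n i<n (r , r∈R , inj₁ j≡i+r))

thetaMaps-intro : ∀ {n m t u R S} .{{_ : NonZero n}} .{{_ : NonZero m}} → (t + u) * m ≡ n →
                  MapsEdges n (theta n m t) R S → MapsEdges n (theta n m u) S R →
                  ThetaMaps n m t R S
thetaMaps-intro {n} {m} {t} {u} [t+u]*m≡n R→S S→R a b a<n b<n =
  (λ e → theta n m u a , theta n m u b , theta<n u a , theta<n u b ,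
         mapEdge S→R a<n b<n e , theta-cancel [u+t]*m≡n a<n , theta-cancel [u+t]*m≡n b<n) ,
  λ { (x , y , x<n , y<n , e , refl , refl) → mapEdge R→S x<n y<n e }
  where
  [u+t]*m≡n : (u + t) * m ≡ n
  [u+t]*m≡n = trans (cong (_* m) (+-comm u t)) [t+u]*m≡n

[t+[n/m∸t]]*m≡n : ∀ {n m t} .{{_ : NonZero m}} → m ∣ n → t ≤ n / m → (t + (n / m ∸ t)) * m ≡ n
[t+[n/m∸t]]*m≡n {n} {m} {t} m∣n t≤n/m = begin
  (t + (n / m ∸ t)) * m ≡⟨ cong (_* m) (m+[n∸m]≡n t≤n/m) ⟩
  n / m * m             ≡⟨ m/n*n≡m m∣n ⟩
  n                     ∎

setEq? : ∀ A B → Dec (SetEq A B)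
setEq? A B = map′ fromSubsets toSubsets (A ⊆? B ×-dec B ⊆? A)
  where
  fromSubsets : A ⊆ B × B ⊆ A → SetEq A B
  fromSubsets (A⊆B , B⊆A) _ = A⊆B , B⊆A

  toSubsets : SetEq A B → A ⊆ B × B ⊆ A
  toSubsets A≐B = proj₁ (A≐B _) , proj₂ (A≐B _)

module _ {n : ℕ} .{{_ : NonZero n}} where

  refRed-cong : ∀ {a b} → a % n ≡ b % n → refRed n a ≡ refRed n b
  refRed-cong {a} {b} a≡b with 2 * (a % n) ≤? n | 2 * (b % n) ≤? n
  ... | yes _   | yes _   = a≡b
  ... | no _    | no _    = cong (n ∸_) a≡b
  ... | yes a≤  | no b≰   = contradiction (subst (λ k → 2 * k ≤ n) a≡b a≤) b≰
  ... | no a≰   | yes b≤  = contradiction (subst (λ k → 2 * k ≤ n) (sym a≡b) b≤) a≰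

  scaleSet-% : ∀ x R → scaleSet n x R ≡ scaleSet n (x % n) R
  scaleSet-% x = map-cong (λ r → refRed-cong (sym ([m%n*o]%n≡[m*o]%n x r n)))

  noScaling-from-residues : ∀ {R S} → (∀ {x} → x < n → ¬ SetEq S (scaleSet n x R)) →
                            ∀ x → ¬ SetEq S (scaleSet n x R)
  noScaling-from-residues {R} {S} none x =
    subst (λ T → ¬ SetEq S T) (sym (scaleSet-% x R)) (none (m%n<n x n))

-- S ≠ xR is required for every residue x, not only for the units mod n.
Type2Checks : (n m : ℕ) .{{_ : NonZero n}} .{{_ : NonZero m}} → ℕ → List ℕ → List ℕ → Set
Type2Checks n m t R S =
  ValidConn n R × ValidConn n S × ¬ SetEq R S × length R ≡ length S × 3 ≤ length R ×
  (∃[ r ] (r ∈ R × r ∈ S × m ∣ gcd n r)) × m ^ 3 ∣ n × 1 ≤ t × t ≤ n / m ∸ 1 ×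
  MapsEdges n (theta n m t) R S × MapsEdges n (theta n m (n / m ∸ t)) S R ×
  (∀ {x} → x < n → ¬ SetEq S (scaleSet n x R))

module _ (n m : ℕ) .{{_ : NonZero n}} .{{_ : NonZero m}} where

  validConn? : ∀ R → Dec (ValidConn n R)
  validConn? R = unique? R ×-dec all? (λ r → (1 ≤? r) ×-dec (2 * r ≤? n)) R

  sharedMultiple? : ∀ R S → Dec (∃[ r ] (r ∈ R × r ∈ S × m ∣ gcd n r))
  sharedMultiple? R S = map′ find (λ (r , r∈R , p) → lose r∈R p)
    (any? (λ r → (r ∈? S) ×-dec (m ∣? gcd n r)) R)

  type2Checks? : ∀ t R S → Dec (Type2Checks n m t R S)
  type2Checks? t R S =
    validConn? R ×-dec validConn? S ×-dec ¬? (setEq? R S) ×-dec length R ≟ length S ×-dec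
    3 ≤? length R ×-dec sharedMultiple? R S ×-dec m ^ 3 ∣? n ×-dec 1 ≤? t ×-dec
    t ≤? n / m ∸ 1 ×-dec mapsEdges? (theta n m t) R S ×-dec
    mapsEdges? (theta n m (n / m ∸ t)) S R ×-dec
    allUpTo? (λ x → ¬? (setEq? S (scaleSet n x R))) n

type2Iso : ∀ {n m t R S} .{{_ : NonZero n}} .{{_ : NonZero m}} →
           Type2Checks n m t R S → Type2Iso n m R S
type2Iso {n} {m} {t} (validR , validS , R≠S , |R|≡|S| , 3≤|R| , shared , m³∣n , 1≤t , t≤ ,
                      R→S , S→R , noScaling) =
  validR , validS , R≠S , |R|≡|S| , 3≤|R| , shared , m³∣n ,
  (t , 1≤t , t≤ , thetaMaps-intro ([t+[n/m∸t]]*m≡n m∣n t≤n/m) R→S S→R) ,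
  λ x _ → noScaling-from-residues noScaling x
  where
  m∣n : m ∣ n
  m∣n = ∣-trans (m∣m*n (m ^ 2)) m³∣n

  t≤n/m : t ≤ n / m
  t≤n/m = ≤-trans t≤ (m∸n≤m (n / m) 1)

record CyclicChecks (n m : ℕ) .{{_ : NonZero n}} .{{_ : NonZero m}}
                    (t : ℕ) (A B C : List ℕ) : Set where
  constructor cyclicChecks
  field
    A→B : Type2Checks n m t A B
    B→C : Type2Checks n m t B C
    C→A : Type2Checks n m t C A
    A→C : Type2Checks n m (2 * t) A C
    C→B : Type2Checks n m (2 * t) C B
    B→A : Type2Checks n m (2 * t) B A

cyclicChecks? : ∀ n m .{{_ : NonZero n}} .{{_ : NonZero m}} t A B C → Dec (CyclicChecks n m t A B C)
cyclicChecks? n m t A B C =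
  map′ (λ (ab , bc , ca , ac , cb , ba) → cyclicChecks ab bc ca ac cb ba)
       (λ (cyclicChecks ab bc ca ac cb ba) → ab , bc , ca , ac , cb , ba)
       (type2Checks? n m t A B ×-dec type2Checks? n m t B C ×-dec type2Checks? n m t C A ×-dec
        type2Checks? n m (2 * t) A C ×-dec type2Checks? n m (2 * t) C B ×-dec
        type2Checks? n m (2 * t) B A)

module _ {n m : ℕ} .{{_ : NonZero n}} .{{_ : NonZero m}} {A B C : List ℕ} where

  cyclic⇒pairwiseType2 : ∀ {t} → CyclicChecks n m t A B C → PairwiseType2 n m A B C
  cyclic⇒pairwiseType2 (cyclicChecks ab bc ca ac cb ba) =
    type2Iso ab , type2Iso ba , type2Iso ac , type2Iso ca , type2Iso bc , type2Iso cb

  pairwiseType2-swap : PairwiseType2 n m A C B → PairwiseType2 n m A B C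
  pairwiseType2-swap (ac , ca , ab , ba , cb , bc) = ab , ba , ac , ca , bc , cb

TheoremChecks : ℕ → Set
TheoremChecks s =
  CyclicChecks 81 3 3 (1 ∷ s ∷ 26 ∷ 28 ∷ []) (s ∷ 10 ∷ 17 ∷ 37 ∷ []) (s ∷ 8 ∷ 19 ∷ 35 ∷ []) ×
  CyclicChecks 81 3 3 (2 ∷ s ∷ 25 ∷ 29 ∷ []) (s ∷ 7 ∷ 20 ∷ 34 ∷ []) (s ∷ 11 ∷ 16 ∷ 38 ∷ []) ×
  CyclicChecks 81 3 3 (s ∷ 4 ∷ 23 ∷ 31 ∷ []) (s ∷ 13 ∷ 14 ∷ 40 ∷ []) (s ∷ 5 ∷ 22 ∷ 32 ∷ [])

theoremChecks : All TheoremChecks sValues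
theoremChecks = from-yes (all? theoremChecks? sValues)
  where
  theoremChecks? : ∀ s → Dec (TheoremChecks s)
  theoremChecks? s = cyclicChecks? 81 3 3 _ _ _ ×-dec cyclicChecks? 81 3 3 _ _ _ ×-dec
                     cyclicChecks? 81 3 3 _ _ _

mainTheorem3 : (s : ℕ) → s ∈ sValues →
    PairwiseType2 81 3 (1 ∷ s ∷ 26 ∷ 28 ∷ []) (s ∷ 8 ∷ 19 ∷ 35 ∷ []) (s ∷ 10 ∷ 17 ∷ 37 ∷ [])
    × PairwiseType2 81 3 (2 ∷ s ∷ 25 ∷ 29 ∷ []) (s ∷ 7 ∷ 20 ∷ 34 ∷ []) (s ∷ 11 ∷ 16 ∷ 38 ∷ [])
    × PairwiseType2 81 3 (s ∷ 4 ∷ 23 ∷ 31 ∷ []) (s ∷ 13 ∷ 14 ∷ 40 ∷ []) (s ∷ 5 ∷ 22 ∷ 32 ∷ [])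
mainTheorem3 s s∈sValues =
  let (d , e , f) = lookup theoremChecks s∈sValues
  in pairwiseType2-swap (cyclic⇒pairwiseType2 d) , cyclic⇒pairwiseType2 e , cyclic⇒pairwiseType2 f
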